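{- Let $\phi$ be an $\textit{LTL}_f$ formula and $\eta=\omega_0\ldots\omega_n\in\Sigma^*$ ($n\ge 0$) a finite trace. Then $\eta\models\phi$ iff there exists a run $s_0\xrightarrow{\alpha_0}s_1\cdots s_n\xrightarrow{\alpha_n}s_{n+1}$ of $T_\phi$ on $\eta$ whose final transition $s_n\xrightarrow{\alpha_n}s_{n+1}$ satisfies $\omega_{\alpha_n}\models s_n$. Consequently, $\phi$ is satisfiable iff some state $\psi_1$ reachable from $\phi$ in $T_\phi$ has a transition $\psi_1\xrightarrow{\alpha}\psi_2$ with $\omega_\alpha\models\psi_1$.
   Context: Fix a finite set $\mathcal{P}$ of atomic propositions; $L=\mathcal{P}\cup\{\neg a: a\in\mathcal{P}\}$ is the set of literals and $\Sigma=2^{L}$. $\textit{LTL}_f$ formulas are in negation normal form: $\phi::=\mathsf{tt}\mid\mathsf{ff}\mid \ell\mid \phi\wedge\phi\mid\phi\vee\phi\mid X\phi\mid X_w\phi\mid \phi U\phi\mid\phi R\phi$, $\ell\in L$. A finite trace is $\eta=\omega_0\ldots\omega_n\in\Sigma^*$ ($n\ge0$), $|\eta|=n+1$, $\eta_i=\omega_i\ldots\omega_n$. Satisfaction: $\eta\models\mathsf{tt}$, $\eta\not\models\mathsf{ff}$; $\eta\models\ell$ iff $\ell\in\omega_0$; $\wedge,\vee$ as usual; $\eta\models X\psi$ iff $|\eta|>1$ and $\eta_1\models\psi$; $\eta\models X_w\psi$ iff $|\eta|=1$ or ($|\eta|>1$ and $\eta_1\models\psi$); $\eta\models\phi_1U\phi_2$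 iff some $0\le i<|\eta|$ has $\eta_i\models\phi_2$ and $\eta_j\models\phi_1$ for all $j<i$; $\eta\models\phi_1R\phi_2$ iff either $\eta_i\models\phi_2$ for all $0\le i<|\eta|$, or some $0\le i<|\eta|$ has $\eta_i\models\phi_1$ and $\eta_j\models\phi_2$ for all $j\le i$. $\phi$ is satisfiable iff some finite trace satisfies it. A letter $\omega\in\Sigma$ is identified with the length-one trace $\omega$. $CF(\phi)$ is the set of conjuncts of $\phi$ and $DF(\phi)$ its set of disjuncts. Normal form $\mathit{NF}(\phi)$ (a set of clauses $\alpha\wedge X(\psi)$): $\mathit{NF}(\mathsf{ff})=\emptyset$; $\mathit{NF}(\phi)=\{\phi\wedge X(\mathsf{tt})\}$ if $\phi$ is $\mathsf{tt}$ or a literal; $\mathit{NF}(X\phi)=\mathit{NF}(X_w\phi)=\{\mathsf{tt}\wedge X(\psi)\mid\psi\in DF(\phi)\}$; $\mathit{NF}(\phi_1U\phi_2)=\mathit{NF}(\phi_2)\cup\mathit{NF}(\phi_1\wedge X(\phi_1U\phi_2))$; $\mathit{NF}(\phi_1R\phi_2)=\mathit{NF}(\phi_1\wedge\phi_2)\cup\mathit{NF}(\phi_2\wedge X(\phi_1R\phi_2))$; $\mathit{NF}(\phi_1\vee\phi_2)=\mathit{NF}(\phi_1)\cup\mathit{NF}(\phi_2)$; $\mathit{NF}(\phi_1\wedge\phi_2)=\{(\alpha_1\wedge\alpha_2)\wedge X(\psi_1\wedge\psi_2)\mid \alpha_i\wedge X(\psi_i)\in\mathit{NF}(\phi_i)\}$.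 Every label $\alpha$ is a conjunction of literals and $\mathsf{tt}$; $\omega_\alpha\in\Sigma$ is the set of literals among its conjuncts $CF(\alpha)$. $T_\phi$: initial state $\phi$; transitions $\psi_1\xrightarrow{\alpha}\psi_2$ iff $\alpha\wedge X(\psi_2)\in\mathit{NF}(\psi_1)$; states form the smallest set containing $\phi$ closed under transitions. A run of $T_\phi$ on $\eta=\omega_0\ldots\omega_n$ is a sequence of transitions $s_0\xrightarrow{\alpha_0}s_1\cdots s_n\xrightarrow{\alpha_n}s_{n+1}$ with $s_0=\phi$ and $\omega_i\models\alpha_i$ for all $i$; $\psi$ is reachable from $\phi$ if some run ends in $\psi$ (including $\phi$ itself). -}

module Defs where

open import Data.Nat using (ℕ; zero; suc; _<_; _≤_)
open import Data.Fin using (Fin; zero; suc; toℕ; fromℕ<; inject₁)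
import Data.Fin as Fin
open import Data.Bool using (Bool; true; false; T; _∨_)
open import Data.List using (List; []; _∷_; _++_; map; concatMap)
open import Data.Bool.ListAction using (any)
open import Data.List.Membership.Propositional using (_∈_)
open import Data.Product using (Σ; _×_; _,_; ∃)
open import Data.Sum using (_⊎_)
open import Data.Unit using (⊤)
open import Data.Empty using (⊥)
open import Relation.Nullary.Decidable using (⌊_⌋)
open import Relation.Binary.PropositionalEquality using (_≡_)

-- Atomic propositions: the finite set 𝒫 is Fin k.
data Literal (k : ℕ) : Set where
  pos : Fin k → Literal k
  neg : Fin k → Literal k

litEq : ∀ {k} → Literal k → Literal k → Bool
litEq (pos a) (pos b) = ⌊ a Fin.≟ b ⌋
litEq (neg a) (neg b) = ⌊ a Fin.≟ b ⌋
litEq _ _ = false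

-- A letter ω ∈ Σ = 2^L, as a characteristic function of a set of literals.
Letter : ℕ → Set
Letter k = Literal k → Bool

-- LTLf formulas in negation normal form
data Formula (k : ℕ) : Set where
  tt ff : Formula k
  lit   : Literal k → Formula k
  _∧'_ _∨'_ : Formula k → Formula k → Formula k
  X Xw  : Formula k → Formula k
  _U_ _R_ : Formula k → Formula k → Formula k

data Trace (k : ℕ) : Set where
  [_] : Letter k → Trace k
  _◂_ : Letter k → Trace k → Trace k

len : ∀ {k} → Trace k → ℕ
len [ _ ] = 1
len (_ ◂ η) = suc (len η)

suffix : ∀ {k} (η : Trace k) → Fin (len η) → Trace k
suffix [ ω ] zero = [ ω ]
suffix (ω ◂ η) zero = ω ◂ η
suffix (_ ◂ η) (suc i) = suffix η i

at : ∀ {k} (η : Trace k) → Fin (len η) → Letter k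
at [ ω ] zero = ω
at (ω ◂ η) zero = ω
at (ω ◂ η) (suc i) = at η i

head : ∀ {k} → Trace k → Letter k
head [ ω ] = ω
head (ω ◂ _) = ω

lastIdx : ∀ {k} (η : Trace k) → Fin (len η)
lastIdx [ _ ] = zero
lastIdx (_ ◂ η) = suc (lastIdx η)

infix 4 _⊨_
_⊨_ : ∀ {k} → Trace k → Formula k → Set
η ⊨ tt = ⊤
η ⊨ ff = ⊥
η ⊨ lit l = T (head η l)
η ⊨ (φ ∧' ψ) = (η ⊨ φ) × (η ⊨ ψ)
η ⊨ (φ ∨' ψ) = (η ⊨ φ) ⊎ (η ⊨ ψ)
η ⊨ X ψ = Σ (1 < len η) λ p → suffix η (fromℕ< p) ⊨ ψ
η ⊨ Xw ψ = (len η ≡ 1) ⊎ (Σ (1 < len η) λ p → suffix η (fromℕ< p) ⊨ ψ)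
η ⊨ (φ₁ U φ₂) = Σ (Fin (len η)) λ i →
  (suffix η i ⊨ φ₂) × (∀ (j : Fin (len η)) → toℕ j < toℕ i → suffix η j ⊨ φ₁)
η ⊨ (φ₁ R φ₂) = (∀ (i : Fin (len η)) → suffix η i ⊨ φ₂) ⊎
  (Σ (Fin (len η)) λ i → (suffix η i ⊨ φ₁) ×
     (∀ (j : Fin (len η)) → toℕ j ≤ toℕ i → suffix η j ⊨ φ₂))

Satisfiable : ∀ {k} → Formula k → Set
Satisfiable {k} φ = Σ (Trace k) λ η → η ⊨ φ

CF : ∀ {k} → Formula k → List (Formula k)
CF (φ ∧' ψ) = CF φ ++ CF ψ
CF φ = φ ∷ []

DF : ∀ {k} → Formula k → List (Formula k)
DF (φ ∨' ψ) = DF φ ++ DF ψ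
DF φ = φ ∷ []

-- A clause α ∧ X(ψ) is represented by the pair (α , ψ)
Clause : ℕ → Set
Clause k = Formula k × Formula k

nfX : ∀ {k} → Formula k → List (Clause k)
nfX φ = map (λ ψ → (tt , ψ)) (DF φ)

nfAnd : ∀ {k} → List (Clause k) → List (Clause k) → List (Clause k)
nfAnd N₁ N₂ = concatMap (λ { (α₁ , ψ₁) → map (λ { (α₂ , ψ₂) → ((α₁ ∧' α₂) , (ψ₁ ∧' ψ₂)) }) N₂ }) N₁

NF : ∀ {k} → Formula k → List (Clause k)
NF ff = []
NF tt = (tt , tt) ∷ []
NF (lit l) = (lit l , tt) ∷ []
NF (X φ) = nfX φ
NF (Xw φ) = nfX φ
NF (φ₁ U φ₂) = NF φ₂ ++ nfAnd (NF φ₁) (nfX (φ₁ U φ₂))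
NF (φ₁ R φ₂) = nfAnd (NF φ₁) (NF φ₂) ++ nfAnd (NF φ₂) (nfX (φ₁ R φ₂))
NF (φ₁ ∨' φ₂) = NF φ₁ ++ NF φ₂
NF (φ₁ ∧' φ₂) = nfAnd (NF φ₁) (NF φ₂)

Trans : ∀ {k} → Formula k → Formula k → Formula k → Set
Trans ψ₁ α ψ₂ = (α , ψ₂) ∈ NF ψ₁

isLit : ∀ {k} → Literal k → Formula k → Bool
isLit l (lit l') = litEq l l'
isLit l _ = false

ωof : ∀ {k} → Formula k → Letter k
ωof α l = any (isLit l) (CF α)

_⊨ₗ_ : ∀ {k} → Letter k → Formula k → Set
ω ⊨ₗ φ = [ ω ] ⊨ φ

record Run {k} (φ : Formula k) (η : Trace k) : Set where
  field
    state : Fin (suc (len η)) → Formula k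
    label : Fin (len η) → Formula k
    start : state zero ≡ φ
    step  : ∀ (i : Fin (len η)) → Trans (state (inject₁ i)) (label i) (state (suc i))
    reads : ∀ (i : Fin (len η)) → at η i ⊨ₗ label i

finalState : ∀ {k} {φ : Formula k} {η : Trace k} → Run φ η → Formula k
finalState {η = η} r = Run.state r (suc (lastIdx η))

Reachable : ∀ {k} → Formula k → Formula k → Set
Reachable {k} φ ψ = (ψ ≡ φ) ⊎ (Σ (Trace k) λ η → Σ (Run φ η) λ r → finalState r ≡ ψ)

-- Each clause α ∧ X(ψ) of NF(φ) unfolds φ by one letter: ω·η ⊨ φ iff some transition
-- φ --α--> ψ has ω ⊨ α and η ⊨ ψ (both directions by induction on φ, unfolding U and R
-- once). Iterating this along the trace turns models into runs and back. At the last
-- letter nothing is left to read, and the remaining condition is the letter ω_α: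
-- labels are conjunctions of literals, so ω ⊨ α iff ω_α ⊆ ω, and satisfaction of an
-- NNF formula on a single letter is monotone in that letter. For satisfiability, the
-- state read by the accepting last transition is reachable; conversely a run reaching
-- ψ₁, extended by the letter ω_α, is a model of φ.
module Submission where

open import Defs
open import Data.Nat using (ℕ; _<_; z≤n; s≤s)
open import Data.Fin using (zero; suc; fromℕ<; inject₁)
open import Data.Bool using (T)
open import Data.List using (List; []; _∷_; map)
open import Data.List.Membership.Propositional using (_∈_; find)
open import Data.List.Membership.Propositional.Properties
  using (∈-++⁺ˡ; ∈-++⁺ʳ; ∈-++⁻; ∈-map⁺; ∈-map⁻; ∈-concatMap⁺; ∈-concatMap⁻)
open import Data.List.Relation.Unary.Any using (here)
import Data.List.Relation.Unary.Any as Any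
open import Data.List.Relation.Unary.Any.Properties using (any⁺; any⁻; ++⁻)
import Data.List.Relation.Binary.Subset.Propositional.Properties as ⊆
open import Data.Product using (Σ; ∃; ∃₂; _×_; _,_)
open import Data.Sum using (_⊎_; inj₁; inj₂)
import Data.Sum as Sum
open import Data.Unit using (tt)
open import Data.Empty using (⊥-elim)
open import Relation.Nullary.Decidable using (toWitness; fromWitness)
open import Relation.Binary.PropositionalEquality using (_≡_; _≢_; refl; cong; subst; sym)
open import Function.Base using (_∘′_)
open import Function.Bundles using (_⇔_; mk⇔)

private
  variable
    k : ℕ
    φ φ₁ φ₂ ψ ψ₁ ψ₂ α α₁ α₂ θ : Formula k
    ω ω′ : Letter k
    η ζ : Trace k
    c₁ c₂ : Clause k
    N₁ N₂ : List (Clause k)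

_∧ᶜ_ : Clause k → Clause k → Clause k
(α₁ , ψ₁) ∧ᶜ (α₂ , ψ₂) = α₁ ∧' α₂ , ψ₁ ∧' ψ₂

∈-nfAnd⁺ : c₁ ∈ N₁ → c₂ ∈ N₂ → c₁ ∧ᶜ c₂ ∈ nfAnd N₁ N₂
∈-nfAnd⁺ c₁∈N₁ c₂∈N₂ = ∈-concatMap⁺ _ (Any.map (λ { refl → ∈-map⁺ _ c₂∈N₂ }) c₁∈N₁)

∈-nfAnd⁻ : ∀ N₁ {N₂} {c : Clause k} → c ∈ nfAnd N₁ N₂ →
  ∃₂ λ c₁ c₂ → c₁ ∈ N₁ × c₂ ∈ N₂ × c ≡ c₁ ∧ᶜ c₂
∈-nfAnd⁻ N₁ {N₂} c∈ with find (∈-concatMap⁻ (λ c₁ → map (c₁ ∧ᶜ_) N₂) {xs = N₁} c∈)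
... | c₁ , c₁∈N₁ , c∈map with ∈-map⁻ (c₁ ∧ᶜ_) c∈map
...   | c₂ , c₂∈N₂ , refl = c₁ , c₂ , c₁∈N₁ , c₂∈N₂ , refl

data DFView {k} : Formula k → Set where
  disj   : (φ₁ φ₂ : Formula k) → DFView (φ₁ ∨' φ₂)
  single : DF φ ≡ φ ∷ [] → DFView φ

dfView : (φ : Formula k) → DFView φ
dfView (φ₁ ∨' φ₂) = disj φ₁ φ₂
dfView tt         = single refl
dfView ff         = single refl
dfView (lit l)    = single refl
dfView (φ₁ ∧' φ₂) = single refl
dfView (X φ)      = single refl
dfView (Xw φ)     = single refl
dfView (φ₁ U φ₂)  = single refl
dfView (φ₁ R φ₂)  = single refl

DF-sound : ∀ φ → ψ ∈ DF φ → η ⊨ ψ → η ⊨ φ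
DF-sound φ ψ∈ ⊨ψ with dfView φ
... | disj φ₁ φ₂ = Sum.map (λ ψ∈₁ → DF-sound φ₁ ψ∈₁ ⊨ψ) (λ ψ∈₂ → DF-sound φ₂ ψ∈₂ ⊨ψ) (∈-++⁻ (DF φ₁) ψ∈)
... | single eq with subst (_ ∈_) eq ψ∈
...   | here refl = ⊨ψ

DF-complete : ∀ φ → η ⊨ φ → ∃ λ ψ → ψ ∈ DF φ × η ⊨ ψ
DF-complete φ ⊨φ with dfView φ | ⊨φ
... | disj φ₁ φ₂ | inj₁ ⊨φ₁ = let ψ , ψ∈ , ⊨ψ = DF-complete φ₁ ⊨φ₁ in ψ , ∈-++⁺ˡ ψ∈ , ⊨ψ
... | disj φ₁ φ₂ | inj₂ ⊨φ₂ = let ψ , ψ∈ , ⊨ψ = DF-complete φ₂ ⊨φ₂ in ψ , ∈-++⁺ʳ (DF φ₁) ψ∈ , ⊨ψ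
... | single eq  | _        = φ , subst (_ ∈_) (sym eq) (here refl) , ⊨φ

DF-nonempty : ∀ (φ : Formula k) → ∃ λ ψ → ψ ∈ DF φ
DF-nonempty φ with dfView φ
... | disj φ₁ φ₂ = let ψ , ψ∈ = DF-nonempty φ₁ in ψ , ∈-++⁺ˡ ψ∈
... | single eq  = φ , subst (_ ∈_) (sym eq) (here refl)

1<len-◂ : ∀ (ω : Letter k) η → 1 < len (ω ◂ η)
1<len-◂ ω [ _ ]   = s≤s (s≤s z≤n)
1<len-◂ ω (_ ◂ _) = s≤s (s≤s z≤n)

len-◂≢1 : ∀ (ω : Letter k) η → len (ω ◂ η) ≢ 1
len-◂≢1 ω [ _ ]   ()
len-◂≢1 ω (_ ◂ _) ()

suffix-◂-1 : ∀ (ω : Letter k) η (p : 1 < len (ω ◂ η)) → suffix (ω ◂ η) (fromℕ< p) ≡ η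
suffix-◂-1 ω [ _ ]   (s≤s (s≤s z≤n)) = refl
suffix-◂-1 ω (_ ◂ _) (s≤s (s≤s z≤n)) = refl

◂-⊨-X⁺ : ∀ ψ → η ⊨ ψ → (ω ◂ η) ⊨ X ψ
◂-⊨-X⁺ {η = η} {ω = ω} ψ ⊨ψ =
  1<len-◂ ω η , subst (_⊨ ψ) (sym (suffix-◂-1 ω η (1<len-◂ ω η))) ⊨ψ

◂-⊨-X⁻ : ∀ ψ → (ω ◂ η) ⊨ X ψ → η ⊨ ψ
◂-⊨-X⁻ {ω = ω} {η = η} ψ (p , ⊨ψ) = subst (_⊨ ψ) (suffix-◂-1 ω η p) ⊨ψ

infix 4 _⊑_
_⊑_ : Letter k → Letter k → Set
ω ⊑ ω′ = ∀ l → T (ω l) → T (ω′ l)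

-- Holds because formulas are in negation normal form.
⊨ₗ-mono : ∀ φ → ω ⊑ ω′ → ω ⊨ₗ φ → ω′ ⊨ₗ φ
⊨ₗ-mono tt         ω⊑ _            = tt
⊨ₗ-mono (lit l)    ω⊑ ⊨l           = ω⊑ l ⊨l
⊨ₗ-mono (φ₁ ∧' φ₂) ω⊑ (⊨φ₁ , ⊨φ₂)  = ⊨ₗ-mono φ₁ ω⊑ ⊨φ₁ , ⊨ₗ-mono φ₂ ω⊑ ⊨φ₂
⊨ₗ-mono (φ₁ ∨' φ₂) ω⊑ (inj₁ ⊨φ₁)   = inj₁ (⊨ₗ-mono φ₁ ω⊑ ⊨φ₁)
⊨ₗ-mono (φ₁ ∨' φ₂) ω⊑ (inj₂ ⊨φ₂)   = inj₂ (⊨ₗ-mono φ₂ ω⊑ ⊨φ₂)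
⊨ₗ-mono (X φ)      ω⊑ (s≤s () , _)
⊨ₗ-mono (Xw φ)     ω⊑ (inj₁ len≡1) = inj₁ len≡1
⊨ₗ-mono (Xw φ)     ω⊑ (inj₂ (s≤s () , _))
⊨ₗ-mono (φ₁ U φ₂)  ω⊑ (zero , ⊨φ₂ , _) = zero , ⊨ₗ-mono φ₂ ω⊑ ⊨φ₂ , λ _ ()
⊨ₗ-mono (φ₁ R φ₂)  ω⊑ (inj₁ ⊨φ₂) = inj₁ λ { zero → ⊨ₗ-mono φ₂ ω⊑ (⊨φ₂ zero) }
⊨ₗ-mono (φ₁ R φ₂)  ω⊑ (inj₂ (zero , ⊨φ₁ , ⊨φ₂)) =
  inj₂ (zero , ⊨ₗ-mono φ₁ ω⊑ ⊨φ₁ , λ { zero _ → ⊨ₗ-mono φ₂ ω⊑ (⊨φ₂ zero z≤n) })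

litEq⇒≡ : ∀ (l l′ : Literal k) → T (litEq l l′) → l ≡ l′
litEq⇒≡ (pos a) (pos b) eq = cong pos (toWitness eq)
litEq⇒≡ (neg a) (neg b) eq = cong neg (toWitness eq)

litEq-refl : ∀ (l : Literal k) → T (litEq l l)
litEq-refl (pos a) = fromWitness refl
litEq-refl (neg a) = fromWitness refl

ωof-lit : ∀ (l : Literal k) → T (ωof (lit l) l)
ωof-lit l = any⁺ {xs = CF (lit l)} (isLit l) (here (litEq-refl l))

ωof-∧ˡ : ∀ (α₁ α₂ : Formula k) → ωof α₁ ⊑ ωof (α₁ ∧' α₂)
ωof-∧ˡ α₁ α₂ l = ⊆.any⁺ (isLit l) (⊆.xs⊆xs++ys (CF α₁) (CF α₂))

ωof-∧ʳ : ∀ (α₁ α₂ : Formula k) → ωof α₂ ⊑ ωof (α₁ ∧' α₂)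
ωof-∧ʳ α₁ α₂ l = ⊆.any⁺ (isLit l) (⊆.xs⊆ys++xs (CF α₂) (CF α₁))

ωof-∧⁻ : ∀ (α₁ α₂ : Formula k) l → T (ωof (α₁ ∧' α₂) l) → T (ωof α₁ l) ⊎ T (ωof α₂ l)
ωof-∧⁻ α₁ α₂ l = Sum.map (any⁺ (isLit l)) (any⁺ (isLit l)) ∘′ ++⁻ (CF α₁) ∘′ any⁻ (isLit l) _

data IsLabel {k} : Formula k → Set where
  tt  : IsLabel tt
  lit : ∀ l → IsLabel (lit l)
  _∧_ : IsLabel φ₁ → IsLabel φ₂ → IsLabel (φ₁ ∧' φ₂)

ωof-⊑ : IsLabel α → ω ⊨ₗ α → ωof α ⊑ ω
ωof-⊑ tt       _   l ()
ωof-⊑ (lit l′) ⊨l′ l ∈ωof with any⁻ (isLit l) (CF (lit l′)) ∈ωof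
... | here eq rewrite litEq⇒≡ l l′ eq = ⊨l′
ωof-⊑ (_∧_ {φ₁} {φ₂} lab₁ lab₂) (⊨α₁ , ⊨α₂) l ∈ωof with ωof-∧⁻ φ₁ φ₂ l ∈ωof
... | inj₁ ∈ωof₁ = ωof-⊑ lab₁ ⊨α₁ l ∈ωof₁
... | inj₂ ∈ωof₂ = ωof-⊑ lab₂ ⊨α₂ l ∈ωof₂

Trans-label : ∀ φ → Trans φ α ψ → IsLabel α
Trans-label tt       (here refl) = tt
Trans-label (lit l)  (here refl) = lit l
Trans-label (X φ)    t with ∈-map⁻ (tt ,_) t
... | _ , _ , refl = tt
Trans-label (Xw φ)   t with ∈-map⁻ (tt ,_) t
... | _ , _ , refl = tt
Trans-label (φ₁ ∨' φ₂) t with ∈-++⁻ (NF φ₁) t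
... | inj₁ t₁ = Trans-label φ₁ t₁
... | inj₂ t₂ = Trans-label φ₂ t₂
Trans-label (φ₁ ∧' φ₂) t with ∈-nfAnd⁻ (NF φ₁) t
... | _ , _ , t₁ , t₂ , refl = Trans-label φ₁ t₁ ∧ Trans-label φ₂ t₂
Trans-label (φ₁ U φ₂) t with ∈-++⁻ (NF φ₂) t
... | inj₁ t₂ = Trans-label φ₂ t₂
... | inj₂ t′ with ∈-nfAnd⁻ (NF φ₁) t′
...   | _ , _ , t₁ , here refl , refl = Trans-label φ₁ t₁ ∧ tt
Trans-label (φ₁ R φ₂) t with ∈-++⁻ (nfAnd (NF φ₁) (NF φ₂)) t
... | inj₁ t′ with ∈-nfAnd⁻ (NF φ₁) t′
...   | _ , _ , t₁ , t₂ , refl = Trans-label φ₁ t₁ ∧ Trans-label φ₂ t₂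
Trans-label (φ₁ R φ₂) t | inj₂ t′ with ∈-nfAnd⁻ (NF φ₂) t′
...   | _ , _ , t₂ , here refl , refl = Trans-label φ₂ t₂ ∧ tt

Trans-∧ : ∀ φ₁ φ₂ → Trans φ₁ α₁ ψ₁ → Trans φ₂ α₂ ψ₂ → Trans (φ₁ ∧' φ₂) (α₁ ∧' α₂) (ψ₁ ∧' ψ₂)
Trans-∧ φ₁ φ₂ = ∈-nfAnd⁺

Trans-∨ˡ : ∀ φ₁ φ₂ → Trans φ₁ α ψ → Trans (φ₁ ∨' φ₂) α ψ
Trans-∨ˡ φ₁ φ₂ = ∈-++⁺ˡ

Trans-∨ʳ : ∀ φ₁ φ₂ → Trans φ₂ α ψ → Trans (φ₁ ∨' φ₂) α ψ
Trans-∨ʳ φ₁ φ₂ = ∈-++⁺ʳ (NF φ₁)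

Trans-X : ∀ φ → ψ ∈ DF φ → Trans (X φ) tt ψ
Trans-X φ = ∈-map⁺ (tt ,_)

Trans-Xw : ∀ φ → ψ ∈ DF φ → Trans (Xw φ) tt ψ
Trans-Xw φ = ∈-map⁺ (tt ,_)

Trans-U-now : ∀ φ₁ φ₂ → Trans φ₂ α ψ → Trans (φ₁ U φ₂) α ψ
Trans-U-now φ₁ φ₂ = ∈-++⁺ˡ

Trans-U-later : ∀ φ₁ φ₂ → Trans φ₁ α ψ → Trans (φ₁ U φ₂) (α ∧' tt) (ψ ∧' (φ₁ U φ₂))
Trans-U-later φ₁ φ₂ t = ∈-++⁺ʳ (NF φ₂) (∈-nfAnd⁺ t (here refl))

Trans-R-now : ∀ φ₁ φ₂ → Trans φ₁ α₁ ψ₁ → Trans φ₂ α₂ ψ₂ → Trans (φ₁ R φ₂) (α₁ ∧' α₂) (ψ₁ ∧' ψ₂)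
Trans-R-now φ₁ φ₂ t₁ t₂ = ∈-++⁺ˡ (∈-nfAnd⁺ t₁ t₂)

Trans-R-later : ∀ φ₁ φ₂ → Trans φ₂ α ψ → Trans (φ₁ R φ₂) (α ∧' tt) (ψ ∧' (φ₁ R φ₂))
Trans-R-later φ₁ φ₂ t = ∈-++⁺ʳ (nfAnd (NF φ₁) (NF φ₂)) (∈-nfAnd⁺ t (here refl))

Trans-◂-⊨ : ∀ φ → Trans φ α ψ → ω ⊨ₗ α → η ⊨ ψ → (ω ◂ η) ⊨ φ
Trans-◂-⊨ tt      (here refl) _ _ = tt
Trans-◂-⊨ (lit l) (here refl) ⊨l _ = ⊨l
Trans-◂-⊨ {ω = ω} (X φ) t _ ⊨ψ with ∈-map⁻ (tt ,_) t
... | _ , ψ∈ , refl = ◂-⊨-X⁺ {ω = ω} φ (DF-sound φ ψ∈ ⊨ψ)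
Trans-◂-⊨ {ω = ω} (Xw φ) t _ ⊨ψ with ∈-map⁻ (tt ,_) t
... | _ , ψ∈ , refl = inj₂ (◂-⊨-X⁺ {ω = ω} φ (DF-sound φ ψ∈ ⊨ψ))
Trans-◂-⊨ (φ₁ ∨' φ₂) t ⊨α ⊨ψ with ∈-++⁻ (NF φ₁) t
... | inj₁ t₁ = inj₁ (Trans-◂-⊨ φ₁ t₁ ⊨α ⊨ψ)
... | inj₂ t₂ = inj₂ (Trans-◂-⊨ φ₂ t₂ ⊨α ⊨ψ)
Trans-◂-⊨ (φ₁ ∧' φ₂) t ⊨α ⊨ψ with ∈-nfAnd⁻ (NF φ₁) t | ⊨α | ⊨ψ
... | _ , _ , t₁ , t₂ , refl | ⊨α₁ , ⊨α₂ | ⊨ψ₁ , ⊨ψ₂ =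
  Trans-◂-⊨ φ₁ t₁ ⊨α₁ ⊨ψ₁ , Trans-◂-⊨ φ₂ t₂ ⊨α₂ ⊨ψ₂
Trans-◂-⊨ (φ₁ U φ₂) t ⊨α ⊨ψ with ∈-++⁻ (NF φ₂) t
... | inj₁ t₂ = zero , Trans-◂-⊨ φ₂ t₂ ⊨α ⊨ψ , λ _ ()
... | inj₂ t′ with ∈-nfAnd⁻ (NF φ₁) t′ | ⊨α | ⊨ψ
...   | _ , _ , t₁ , here refl , refl | ⊨α₁ , _ | ⊨ψ₁ , (i , ⊨φ₂ , ⊨φ₁) =
  suc i , ⊨φ₂ , λ { zero _ → Trans-◂-⊨ φ₁ t₁ ⊨α₁ ⊨ψ₁ ; (suc j) (s≤s j<i) → ⊨φ₁ j j<i }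
Trans-◂-⊨ (φ₁ R φ₂) t ⊨α ⊨ψ with ∈-++⁻ (nfAnd (NF φ₁) (NF φ₂)) t
... | inj₁ t′ with ∈-nfAnd⁻ (NF φ₁) t′ | ⊨α | ⊨ψ
...   | _ , _ , t₁ , t₂ , refl | ⊨α₁ , ⊨α₂ | ⊨ψ₁ , ⊨ψ₂ =
  inj₂ (zero , Trans-◂-⊨ φ₁ t₁ ⊨α₁ ⊨ψ₁ , λ { zero _ → Trans-◂-⊨ φ₂ t₂ ⊨α₂ ⊨ψ₂ })
Trans-◂-⊨ (φ₁ R φ₂) t ⊨α ⊨ψ | inj₂ t′ with ∈-nfAnd⁻ (NF φ₂) t′ | ⊨α | ⊨ψ
... | _ , _ , t₂ , here refl , refl | ⊨α₂ , _ | ⊨ψ₂ , inj₁ ⊨φ₂ =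
  inj₁ λ { zero → Trans-◂-⊨ φ₂ t₂ ⊨α₂ ⊨ψ₂ ; (suc i) → ⊨φ₂ i }
... | _ , _ , t₂ , here refl , refl | ⊨α₂ , _ | ⊨ψ₂ , inj₂ (i , ⊨φ₁ , ⊨φ₂) =
  inj₂ (suc i , ⊨φ₁ , λ { zero _ → Trans-◂-⊨ φ₂ t₂ ⊨α₂ ⊨ψ₂ ; (suc j) (s≤s j≤i) → ⊨φ₂ j j≤i })

-- ω_α is the least letter enabling the transition.
Trans-⊨ₗ : ∀ φ → Trans φ α ψ → ω ⊨ₗ α → ωof α ⊨ₗ φ → ω ⊨ₗ φ
Trans-⊨ₗ φ t ⊨α = ⊨ₗ-mono φ (ωof-⊑ (Trans-label φ t) ⊨α)

Step : Formula k → Letter k → Trace k → Set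
Step {k} φ ω η = Σ (Formula k) λ α → Σ (Formula k) λ ψ → Trans φ α ψ × ω ⊨ₗ α × η ⊨ ψ

◂-⊨-Step : ∀ φ → (ω ◂ η) ⊨ φ → Step φ ω η
◂-⊨-Step tt      _  = tt , tt , here refl , tt , tt
◂-⊨-Step (lit l) ⊨l = lit l , tt , here refl , ⊨l , tt
◂-⊨-Step {ω = ω} (X φ) ⊨Xφ =
  let ψ , ψ∈ , ⊨ψ = DF-complete φ (◂-⊨-X⁻ {ω = ω} φ ⊨Xφ) in tt , ψ , Trans-X φ ψ∈ , tt , ⊨ψ
◂-⊨-Step {ω = ω} {η = η} (Xw φ) (inj₁ len≡1) = ⊥-elim (len-◂≢1 ω η len≡1)
◂-⊨-Step {ω = ω} (Xw φ) (inj₂ ⊨Xφ) =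
  let ψ , ψ∈ , ⊨ψ = DF-complete φ (◂-⊨-X⁻ {ω = ω} φ ⊨Xφ) in tt , ψ , Trans-Xw φ ψ∈ , tt , ⊨ψ
◂-⊨-Step (φ₁ ∨' φ₂) (inj₁ ⊨φ₁) = let α , ψ , t , ⊨α , ⊨ψ = ◂-⊨-Step φ₁ ⊨φ₁ in α , ψ , Trans-∨ˡ φ₁ φ₂ t , ⊨α , ⊨ψ
◂-⊨-Step (φ₁ ∨' φ₂) (inj₂ ⊨φ₂) = let α , ψ , t , ⊨α , ⊨ψ = ◂-⊨-Step φ₂ ⊨φ₂ in α , ψ , Trans-∨ʳ φ₁ φ₂ t , ⊨α , ⊨ψ
◂-⊨-Step (φ₁ ∧' φ₂) (⊨φ₁ , ⊨φ₂) =
  let α₁ , ψ₁ , t₁ , ⊨α₁ , ⊨ψ₁ = ◂-⊨-Step φ₁ ⊨φ₁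
      α₂ , ψ₂ , t₂ , ⊨α₂ , ⊨ψ₂ = ◂-⊨-Step φ₂ ⊨φ₂
  in α₁ ∧' α₂ , ψ₁ ∧' ψ₂ , Trans-∧ φ₁ φ₂ t₁ t₂ , (⊨α₁ , ⊨α₂) , (⊨ψ₁ , ⊨ψ₂)
◂-⊨-Step (φ₁ U φ₂) (zero , ⊨φ₂ , _) =
  let α , ψ , t , ⊨α , ⊨ψ = ◂-⊨-Step φ₂ ⊨φ₂ in α , ψ , Trans-U-now φ₁ φ₂ t , ⊨α , ⊨ψ
◂-⊨-Step (φ₁ U φ₂) (suc i , ⊨φ₂ , ⊨φ₁) =
  let α , ψ , t , ⊨α , ⊨ψ = ◂-⊨-Step φ₁ (⊨φ₁ zero (s≤s z≤n))
  in α ∧' tt , ψ ∧' (φ₁ U φ₂) , Trans-U-later φ₁ φ₂ t , (⊨α , tt) ,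
     (⊨ψ , (i , ⊨φ₂ , λ j j<i → ⊨φ₁ (suc j) (s≤s j<i)))
◂-⊨-Step (φ₁ R φ₂) (inj₁ ⊨φ₂) =
  let α , ψ , t , ⊨α , ⊨ψ = ◂-⊨-Step φ₂ (⊨φ₂ zero)
  in α ∧' tt , ψ ∧' (φ₁ R φ₂) , Trans-R-later φ₁ φ₂ t , (⊨α , tt) , (⊨ψ , inj₁ (λ i → ⊨φ₂ (suc i)))
◂-⊨-Step (φ₁ R φ₂) (inj₂ (zero , ⊨φ₁ , ⊨φ₂)) =
  let α₁ , ψ₁ , t₁ , ⊨α₁ , ⊨ψ₁ = ◂-⊨-Step φ₁ ⊨φ₁
      α₂ , ψ₂ , t₂ , ⊨α₂ , ⊨ψ₂ = ◂-⊨-Step φ₂ (⊨φ₂ zero z≤n)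
  in α₁ ∧' α₂ , ψ₁ ∧' ψ₂ , Trans-R-now φ₁ φ₂ t₁ t₂ , (⊨α₁ , ⊨α₂) , (⊨ψ₁ , ⊨ψ₂)
◂-⊨-Step (φ₁ R φ₂) (inj₂ (suc i , ⊨φ₁ , ⊨φ₂)) =
  let α , ψ , t , ⊨α , ⊨ψ = ◂-⊨-Step φ₂ (⊨φ₂ zero z≤n)
  in α ∧' tt , ψ ∧' (φ₁ R φ₂) , Trans-R-later φ₁ φ₂ t , (⊨α , tt) ,
     (⊨ψ , inj₂ (i , ⊨φ₁ , λ j j≤i → ⊨φ₂ (suc j) (s≤s j≤i)))

AcceptingTransition : Formula k → Letter k → Set
AcceptingTransition {k} φ ω = Σ (Formula k) λ α → Σ (Formula k) λ ψ → Trans φ α ψ × ω ⊨ₗ α × ωof α ⊨ₗ φ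

⊨ₗ-AcceptingTransition : ∀ φ → ω ⊨ₗ φ → AcceptingTransition φ ω
⊨ₗ-AcceptingTransition tt      _  = tt , tt , here refl , tt , tt
⊨ₗ-AcceptingTransition (lit l) ⊨l = lit l , tt , here refl , ⊨l , ωof-lit l
⊨ₗ-AcceptingTransition (X φ)   (s≤s () , _)
⊨ₗ-AcceptingTransition (Xw φ)  _  = let ψ , ψ∈ = DF-nonempty φ in tt , ψ , Trans-Xw φ ψ∈ , tt , inj₁ refl
⊨ₗ-AcceptingTransition (φ₁ ∨' φ₂) (inj₁ ⊨φ₁) =
  let α , ψ , t , ⊨α , acc = ⊨ₗ-AcceptingTransition φ₁ ⊨φ₁ in α , ψ , Trans-∨ˡ φ₁ φ₂ t , ⊨α , inj₁ acc
⊨ₗ-AcceptingTransition (φ₁ ∨' φ₂) (inj₂ ⊨φ₂) =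
  let α , ψ , t , ⊨α , acc = ⊨ₗ-AcceptingTransition φ₂ ⊨φ₂ in α , ψ , Trans-∨ʳ φ₁ φ₂ t , ⊨α , inj₂ acc
⊨ₗ-AcceptingTransition (φ₁ ∧' φ₂) (⊨φ₁ , ⊨φ₂) =
  let α₁ , ψ₁ , t₁ , ⊨α₁ , acc₁ = ⊨ₗ-AcceptingTransition φ₁ ⊨φ₁
      α₂ , ψ₂ , t₂ , ⊨α₂ , acc₂ = ⊨ₗ-AcceptingTransition φ₂ ⊨φ₂
  in α₁ ∧' α₂ , ψ₁ ∧' ψ₂ , Trans-∧ φ₁ φ₂ t₁ t₂ , (⊨α₁ , ⊨α₂) ,
     (⊨ₗ-mono φ₁ (ωof-∧ˡ α₁ α₂) acc₁ , ⊨ₗ-mono φ₂ (ωof-∧ʳ α₁ α₂) acc₂)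
⊨ₗ-AcceptingTransition (φ₁ U φ₂) (zero , ⊨φ₂ , _) =
  let α , ψ , t , ⊨α , acc = ⊨ₗ-AcceptingTransition φ₂ ⊨φ₂
  in α , ψ , Trans-U-now φ₁ φ₂ t , ⊨α , (zero , acc , λ _ ())
⊨ₗ-AcceptingTransition (φ₁ R φ₂) (inj₁ ⊨φ₂) =
  let α , ψ , t , ⊨α , acc = ⊨ₗ-AcceptingTransition φ₂ (⊨φ₂ zero)
  in α ∧' tt , ψ ∧' (φ₁ R φ₂) , Trans-R-later φ₁ φ₂ t , (⊨α , tt) ,
     inj₁ (λ { zero → ⊨ₗ-mono φ₂ (ωof-∧ˡ α tt) acc })
⊨ₗ-AcceptingTransition (φ₁ R φ₂) (inj₂ (zero , ⊨φ₁ , ⊨φ₂)) =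
  let α₁ , ψ₁ , t₁ , ⊨α₁ , acc₁ = ⊨ₗ-AcceptingTransition φ₁ ⊨φ₁
      α₂ , ψ₂ , t₂ , ⊨α₂ , acc₂ = ⊨ₗ-AcceptingTransition φ₂ (⊨φ₂ zero z≤n)
  in α₁ ∧' α₂ , ψ₁ ∧' ψ₂ , Trans-R-now φ₁ φ₂ t₁ t₂ , (⊨α₁ , ⊨α₂) ,
     inj₂ (zero , ⊨ₗ-mono φ₁ (ωof-∧ˡ α₁ α₂) acc₁ , λ { zero _ → ⊨ₗ-mono φ₂ (ωof-∧ʳ α₁ α₂) acc₂ })

Accepting : {φ : Formula k} {η : Trace k} → Run φ η → Set
Accepting {η = η} r = ωof (Run.label r (lastIdx η)) ⊨ₗ Run.state r (inject₁ (lastIdx η))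

singletonRun : Trans φ α ψ → ω ⊨ₗ α → Run φ [ ω ]
singletonRun {φ = φ} {α = α} {ψ = ψ} t ⊨α = record
  { state = λ { zero → φ ; (suc _) → ψ }
  ; label = λ _ → α
  ; start = refl
  ; step  = λ { zero → t }
  ; reads = λ { zero → ⊨α }
  }

consRun : Trans φ α ψ → ω ⊨ₗ α → Run ψ η → Run φ (ω ◂ η)
consRun {φ = φ} {α = α} t ⊨α r = record
  { state = λ { zero → φ ; (suc i) → Run.state r i }
  ; label = λ { zero → α ; (suc i) → Run.label r i }
  ; start = refl
  ; step  = λ { zero → subst (Trans φ α) (sym (Run.start r)) t ; (suc i) → Run.step r i }
  ; reads = λ { zero → ⊨α ; (suc i) → Run.reads r i }
  }

tailRun : (r : Run φ (ω ◂ η)) → Run (Run.state r (suc zero)) η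
tailRun r = record
  { state = λ i → Run.state r (suc i)
  ; label = λ i → Run.label r (suc i)
  ; start = refl
  ; step  = λ i → Run.step r (suc i)
  ; reads = λ i → Run.reads r (suc i)
  }

⊨-AcceptingRun : ∀ φ (η : Trace k) → η ⊨ φ → Σ (Run φ η) Accepting
⊨-AcceptingRun φ [ ω ] ⊨φ =
  let _ , _ , t , ⊨α , acc = ⊨ₗ-AcceptingTransition φ ⊨φ in singletonRun t ⊨α , acc
⊨-AcceptingRun φ (ω ◂ η) ⊨φ =
  let _ , ψ , t , ⊨α , ⊨ψ = ◂-⊨-Step φ ⊨φ
      r , acc = ⊨-AcceptingRun ψ η ⊨ψ
  in consRun t ⊨α r , acc

AcceptingRun-⊨ : ∀ (η : Trace k) (r : Run φ η) → Accepting r → η ⊨ φ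
AcceptingRun-⊨ η r acc = subst (η ⊨_) (Run.start r) (from-start η r acc)
  where
  from-start : ∀ η (r : Run φ η) → Accepting r → η ⊨ Run.state r zero
  from-start [ ω ]   r acc = Trans-⊨ₗ (Run.state r zero) (Run.step r zero) (Run.reads r zero) acc
  from-start (ω ◂ η) r acc =
    Trans-◂-⊨ (Run.state r zero) (Run.step r zero) (Run.reads r zero) (from-start η (tailRun r) acc)

infixr 5 _++ᵗ_
_++ᵗ_ : Trace k → Trace k → Trace k
[ ω ]   ++ᵗ ζ = ω ◂ ζ
(ω ◂ η) ++ᵗ ζ = ω ◂ (η ++ᵗ ζ)

Run-++ᵗ-⊨ : ∀ (η : Trace k) (r : Run φ η) → ζ ⊨ finalState r → η ++ᵗ ζ ⊨ φ
Run-++ᵗ-⊨ {ζ = ζ} η r ⊨final = subst (η ++ᵗ ζ ⊨_) (Run.start r) (from-start η r ⊨final)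
  where
  from-start : ∀ η (r : Run φ η) → ζ ⊨ finalState r → η ++ᵗ ζ ⊨ Run.state r zero
  from-start [ ω ]   r ⊨final = Trans-◂-⊨ (Run.state r zero) (Run.step r zero) (Run.reads r zero) ⊨final
  from-start (ω ◂ η) r ⊨final =
    Trans-◂-⊨ (Run.state r zero) (Run.step r zero) (Run.reads r zero) (from-start η (tailRun r) ⊨final)

HasReachableAcceptingTransition : Formula k → Set
HasReachableAcceptingTransition {k} φ = Σ (Formula k) λ ψ₁ → Σ (Formula k) λ α → Σ (Formula k) λ ψ₂ →
  Reachable φ ψ₁ × Trans ψ₁ α ψ₂ × (ωof α ⊨ₗ ψ₁)

Reachable-◂ : Trans φ α ψ → ω ⊨ₗ α → Reachable ψ θ → Reachable φ θ
Reachable-◂ {ω = ω} t ⊨α (inj₁ refl)          = inj₂ ([ ω ] , singletonRun t ⊨α , refl)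
Reachable-◂ {ω = ω} t ⊨α (inj₂ (η , r , fin)) = inj₂ (ω ◂ η , consRun t ⊨α r , fin)

⊨-HasReachableAcceptingTransition : ∀ φ (η : Trace k) → η ⊨ φ → HasReachableAcceptingTransition φ
⊨-HasReachableAcceptingTransition φ [ ω ] ⊨φ =
  let α , ψ , t , _ , acc = ⊨ₗ-AcceptingTransition φ ⊨φ in φ , α , ψ , inj₁ refl , t , acc
⊨-HasReachableAcceptingTransition φ (ω ◂ η) ⊨φ =
  let _ , ψ , t , ⊨α , ⊨ψ = ◂-⊨-Step φ ⊨φ
      ψ₁ , α , ψ₂ , reach , t′ , acc = ⊨-HasReachableAcceptingTransition ψ η ⊨ψ
  in ψ₁ , α , ψ₂ , Reachable-◂ t ⊨α reach , t′ , acc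

HasReachableAcceptingTransition-Satisfiable : ∀ (φ : Formula k) → HasReachableAcceptingTransition φ → Satisfiable φ
HasReachableAcceptingTransition-Satisfiable φ (_ , α , _ , inj₁ refl , _ , acc) = [ ωof α ] , acc
HasReachableAcceptingTransition-Satisfiable φ (_ , α , _ , inj₂ (η , r , refl) , _ , acc) =
  η ++ᵗ [ ωof α ] , Run-++ᵗ-⊨ η r acc

theorem2 : (k : ℕ) (φ : Formula k) →
    ((η : Trace k) →
      (η ⊨ φ) ⇔ (Σ (Run φ η) λ r →
        ωof (Run.label r (lastIdx η)) ⊨ₗ Run.state r (inject₁ (lastIdx η))))
    × (Satisfiable φ ⇔ (Σ (Formula k) λ ψ₁ → Σ (Formula k) λ α → Σ (Formula k) λ ψ₂ →
        Reachable φ ψ₁ × Trans ψ₁ α ψ₂ × (ωof α ⊨ₗ ψ₁)))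
theorem2 k φ =
  (λ η → mk⇔ (⊨-AcceptingRun φ η) (λ (r , acc) → AcceptingRun-⊨ η r acc)) ,
  mk⇔ (λ (η , ⊨φ) → ⊨-HasReachableAcceptingTransition φ η ⊨φ)
      (HasReachableAcceptingTransition-Satisfiable φ)
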